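{- Let $I$ be a perfect matching of $K_{12}$. Then the edge set of $K_{12}-I$ can be decomposed into $5$-star factors.
   Context: A $5$-star is a copy of $K_{1,5}$. A $5$-star factor of a graph $H$ is a spanning subgraph of $H$ each of whose components is a $5$-star; a decomposition into $5$-star factors is a collection of such factors whose edge sets partition the edge set of $H$. -}

module Defs where

open import Level using (0ℓ)
open import Data.Nat using (ℕ)
open import Data.Fin using (Fin)
open import Data.List using (List; length)
open import Data.List.Membership.Propositional using (_∈_)
open import Data.List.Relation.Unary.Unique.Propositional using (Unique)
open import Data.Product using (Σ; ∃; ∃-syntax; _×_; _,_)
open import Data.Sum using (_⊎_)
open import Relation.Nullary using (¬_)
open import Relation.Binary.PropositionalEquality using (_≡_; _≢_; refl) renaming (sym to ≡-sym)
open import Relation.Binary.Construct.Closure.ReflexiveTransitive using (Star)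
open import Function.Bundles using (_⇔_)

record Graph (n : ℕ) : Set₁ where
  field
    Adj   : Fin n → Fin n → Set
    sym   : ∀ {u v} → Adj u v → Adj v u
    irrefl : ∀ {u} → ¬ Adj u u
open Graph public

K : (n : ℕ) → Graph n
K n = record { Adj = λ u v → u ≢ v ; sym = λ p q → p (≡-sym q) ; irrefl = λ p → p refl }

_⊆G_ : ∀ {n} → Graph n → Graph n → Set
G ⊆G H = ∀ {u v} → Adj G u v → Adj H u v

IsPerfectMatching : ∀ {n} → Graph n → Graph n → Set
IsPerfectMatching {n} H M =
  (M ⊆G H) × (∀ v → ∃[ w ] (Adj M v w × (∀ w' → Adj M v w' → w' ≡ w)))

_─_ : ∀ {n} → Graph n → Graph n → Graph n
H ─ I = record
  { Adj    = λ u v → Adj H u v × ¬ Adj I u v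
  ; sym    = λ { (h , ni) → Graph.sym H h , (λ i → ni (Graph.sym I i)) }
  ; irrefl = λ { (h , _) → Graph.irrefl H h }
  }

Reach : ∀ {n} → Graph n → Fin n → Fin n → Set
Reach G = Star (Adj G)

IsStarOn : ∀ {n} → Graph n → Fin n → List (Fin n) → Set
IsStarOn G c C =
  Unique C × length C ≡ 6 × c ∈ C ×
  (∀ {x y} → x ∈ C → y ∈ C →
     Adj G x y ⇔ ((x ≡ c × y ≢ c) ⊎ (y ≡ c × x ≢ c)))

Is5StarFactor : ∀ {n} → Graph n → Graph n → Set
Is5StarFactor H F =
  (F ⊆G H) ×
  (∀ v → ∃[ C ] ∃[ c ] ((∀ w → Reach F v w ⇔ (w ∈ C)) × IsStarOn F c C))

HasStarFactorDecomposition : ∀ {n} → Graph n → Set₁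
HasStarFactorDecomposition {n} H =
  Σ ℕ λ k → Σ (Fin k → Graph n) λ F → (
    (∀ (i : Fin k) → Is5StarFactor H (F i)) ×
    (∀ {u v} → Adj H u v →
       Σ (Fin k) λ i → (Adj (F i) u v × (∀ j → Adj (F j) u v → j ≡ i))))

-- Write I as a fixed-point-free involution p and orient K₁₂ − I so that every vertex has
-- exactly one out-neighbour in each of the other five pairs {y, p y}, the two vertices of a
-- pair never sharing one. Then the two out-stars of a pair form a 5-star factor, and every
-- edge lies in the factor of the pair of its tail and in no other. That each vertex has
-- out-degree 5 is a double count: its out-neighbourhood meets each p-orbit outside its own
-- pair exactly once, so twice its size plus 2 is 12.
module Submission where

open import Defs hiding (sym)
open import Data.Bool using (Bool; true; false; not; if_then_else_; _xor_)
open import Data.Bool.Properties as Bool using (¬-not; not-distribˡ-xor; not-distribʳ-xor; xor-comm)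
open import Data.Fin using (Fin; zero; suc)
open import Data.Fin.Permutation using (permutation)
open import Data.Fin.Properties using (_≟_; _<?_; <-cmp; <-asym)
open import Data.List using (List; _∷_; length; filter; tabulate; allFin; lookup)
open import Data.List.Membership.Propositional using (_∈_)
open import Data.List.Membership.Propositional.Properties using (∈-filter⁺; ∈-filter⁻; ∈-allFin; ∈-lookup)
open import Data.List.Relation.Unary.Any using (here; there; index)
open import Data.List.Relation.Unary.Any.Properties using (lookup-index)
import Data.List.Relation.Unary.All as All
open import Data.List.Relation.Unary.AllPairs using (_∷_)
open import Data.List.Relation.Unary.Unique.Propositional using (Unique)
open import Data.List.Relation.Unary.Unique.Propositional.Properties using (filter⁺; allFin⁺)
open import Relation.Binary.Construct.Closure.ReflexiveTransitive using (ε; _◅_; _◅◅_)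
open import Function.Bundles using (_⇔_; mk⇔; Equivalence)
open import Data.Nat using (ℕ; zero; suc; _+_; _*_)
open import Data.Nat.Properties using (+-0-commutativeMonoid; +-identityʳ; +-cancelʳ-≡; *-cancelˡ-≡)
open import Data.Product using (Σ; _×_; _,_; proj₁; proj₂)
open import Data.Sum as Sum using (_⊎_; inj₁; inj₂; [_,_]′)
open import Data.Empty using (⊥-elim)
open import Function using (_∘_; id)
open import Relation.Nullary using (¬_; Dec; yes; no; does; contradiction)
open import Relation.Unary using (Pred; Decidable)
open import Relation.Nullary.Decidable using (dec-true; dec-false; ¬?; _×-dec_)
open import Relation.Binary.Definitions using (tri<; tri≈; tri>)
open import Relation.Binary.PropositionalEquality using (_≡_; _≢_; refl; sym; trans; cong; cong₂; subst; module ≡-Reasoning)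
open import Algebra.Properties.CommutativeMonoid.Sum +-0-commutativeMonoid using (sum-syntax; ∑-distrib-+; sum-cong-≗; sum-replicate-zero; sum-permute)

𝟙 : ∀ {a} {A : Set a} → Dec A → ℕ
𝟙 a? = if does a? then 1 else 0

𝟙-no : ∀ {a} {A : Set a} (a? : Dec A) → ¬ A → 𝟙 a? ≡ 0
𝟙-no (yes a) ¬a = contradiction a ¬a
𝟙-no (no _)  _  = refl

length-filter-tabulate : ∀ {n p} {A : Set} {P : Pred A p} (P? : Decidable P) (f : Fin n → A) →
  length (filter P? (tabulate f)) ≡ ∑[ i < n ] 𝟙 (P? (f i))
length-filter-tabulate {zero}  P? f = refl
length-filter-tabulate {suc n} P? f with P? (f zero)
... | yes _ = cong suc (length-filter-tabulate P? (f ∘ suc))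
... | no _  = length-filter-tabulate P? (f ∘ suc)

∑-𝟙-≟ : ∀ {n} (c : Fin n) → ∑[ i < n ] 𝟙 (i ≟ c) ≡ 1
∑-𝟙-≟ {suc n} zero    = cong suc (trans (sum-cong-≗ {n} (λ i → 𝟙-no (suc i ≟ zero) λ ())) (sum-replicate-zero n))
∑-𝟙-≟ {suc n} (suc c) = trans (sum-cong-≗ {n} 𝟙-suc) (∑-𝟙-≟ c)
  where
  𝟙-suc : ∀ i → 𝟙 (suc i ≟ suc c) ≡ 𝟙 (i ≟ c)
  𝟙-suc i with i ≟ c
  ... | yes refl = refl
  ... | no  _    = refl

∑-1 : ∀ n → ∑[ i < n ] 1 ≡ n
∑-1 zero    = refl
∑-1 (suc n) = cong suc (∑-1 n)

module _ {n} (p : Fin n → Fin n) (p-involutive : ∀ x → p (p x) ≡ x) where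

  length-filter-transversal :
    ∀ {ℓ} {P : Pred (Fin n) ℓ} (P? : Decidable P) (c : Fin n) → p c ≢ c →
    (∀ {y} → P y → y ≢ c × y ≢ p c) →
    (∀ {y} → P y → ¬ P (p y)) →
    (∀ {y} → y ≢ c → y ≢ p c → P y ⊎ P (p y)) →
    2 * length (filter P? (allFin n)) + 2 ≡ n
  length-filter-transversal P? c pc≢c P⇒∉ends P⇒¬Pp P-meets-orbit = begin
    2 * length (filter P? (allFin n)) + 2     ≡⟨ cong (λ s → 2 * s + 2) (length-filter-tabulate P? id) ⟩
    2 * ∑f + 2                                ≡⟨ cong (λ t → ∑f + t + 2) (+-identityʳ ∑f) ⟩
    ∑f + ∑f + (1 + 1)
      ≡⟨ cong₂ (λ a b → ∑f + a + b) (sum-permute f π) (sym (cong₂ _+_ (∑-𝟙-≟ c) (∑-𝟙-≟ (p c)))) ⟩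
    (∑[ y < n ] f y + ∑[ y < n ] f (p y)) + (∑[ y < n ] δ c y + ∑[ y < n ] δ (p c) y)
      ≡⟨ sym (cong₂ _+_ (∑-distrib-+ f (f ∘ p)) (∑-distrib-+ (δ c) (δ (p c)))) ⟩
    ∑[ y < n ] (f y + f (p y)) + ∑[ y < n ] (δ c y + δ (p c) y)
      ≡⟨ sym (∑-distrib-+ (λ y → f y + f (p y)) (λ y → δ c y + δ (p c) y)) ⟩
    ∑[ y < n ] (f y + f (p y) + (δ c y + δ (p c) y))   ≡⟨ sum-cong-≗ orbit-count ⟩
    ∑[ y < n ] 1                                       ≡⟨ ∑-1 n ⟩
    n                                                  ∎
    where
    open ≡-Reasoning
    f : Fin n → ℕ
    f y = 𝟙 (P? y)
    δ : Fin n → Fin n → ℕ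
    δ z y = 𝟙 (y ≟ z)
    ∑f = ∑[ y < n ] f y
    π = permutation p p p-involutive p-involutive
    orbit-count : ∀ y → f y + f (p y) + (δ c y + δ (p c) y) ≡ 1
    orbit-count y with y ≟ c | y ≟ p c
    ... | yes refl | yes c≡pc = contradiction (sym c≡pc) pc≢c
    ... | yes refl | no _ rewrite 𝟙-no (P? c) (λ Pc → proj₁ (P⇒∉ends Pc) refl)
                                | 𝟙-no (P? (p c)) (λ Ppc → proj₂ (P⇒∉ends Ppc) refl) = refl
    ... | no _ | yes refl rewrite 𝟙-no (P? (p c)) (λ Ppc → proj₂ (P⇒∉ends Ppc) refl)
                                | 𝟙-no (P? (p (p c))) (λ Pppc → proj₁ (P⇒∉ends Pppc) (p-involutive c)) = refl
    ... | no y≢c | no y≢pc with P? y | P? (p y)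
    ...   | yes Py | yes Ppy = contradiction Ppy (P⇒¬Pp Py)
    ...   | yes _  | no _    = refl
    ...   | no _   | yes _   = refl
    ...   | no ¬Py | no ¬Ppy = ⊥-elim ([ ¬Py , ¬Ppy ]′ (P-meets-orbit y≢c y≢pc))

lookup-injective : ∀ {A : Set} {xs : List A} → Unique xs → ∀ {i j} → lookup xs i ≡ lookup xs j → i ≡ j
lookup-injective (_ ∷ _)      {zero}  {zero}  _  = refl
lookup-injective (x∉xs ∷ _)   {zero}  {suc j} xᵢ≡xⱼ = contradiction xᵢ≡xⱼ (All.lookup x∉xs (∈-lookup j))
lookup-injective (x∉xs ∷ _)   {suc i} {zero}  xᵢ≡xⱼ = contradiction (sym xᵢ≡xⱼ) (All.lookup x∉xs (∈-lookup i))
lookup-injective (_ ∷ unique) {suc i} {suc j} xᵢ≡xⱼ = cong suc (lookup-injective unique xᵢ≡xⱼ)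

<?-flip : ∀ {n} {x y : Fin n} → x ≢ y → does (y <? x) ≡ not (does (x <? y))
<?-flip {x = x} {y} x≢y with <-cmp x y
... | tri< x<y _ _ rewrite dec-true (x <? y) x<y | dec-false (y <? x) (<-asym x<y) = refl
... | tri≈ _ x≡y _ = contradiction x≡y x≢y
... | tri> _ _ y<x rewrite dec-true (y <? x) y<x | dec-false (x <? y) (<-asym y<x) = refl

module PairOrientation {n} (p : Fin n → Fin n) (p-involutive : ∀ x → p (p x) ≡ x)
                       (p-fixpoint-free : ∀ x → p x ≢ x) where

  isLower : Fin n → Bool
  isLower x = does (x <? p x)

  rep : Fin n → Fin n
  rep x = if isLower x then x else p x

  -- For pairs P < Q (compared by lower vertices) edges go lower to lower and upper to upper
  -- from P to Q, and cross edges go from Q to P.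
  points : Fin n → Fin n → Bool
  points x y = does (rep x <? rep y) xor (isLower x xor isLower y)

  Arc : Fin n → Fin n → Set
  Arc u v = v ≢ u × v ≢ p u × points u v ≡ true

  isLower-p : ∀ x → isLower (p x) ≡ not (isLower x)
  isLower-p x = trans (cong (λ y → does (p x <? y)) (p-involutive x)) (<?-flip (p-fixpoint-free x ∘ sym))

  rep-p : ∀ x → rep (p x) ≡ rep x
  rep-p x rewrite isLower-p x with isLower x
  ... | true  = p-involutive x
  ... | false = refl

  isLower-rep : ∀ x → isLower (rep x) ≡ true
  isLower-rep x with isLower x in eq
  ... | true  = eq
  ... | false = trans (isLower-p x) (cong not eq)

  rep-member : ∀ x → x ≡ rep x ⊎ x ≡ p (rep x)
  rep-member x with isLower x
  ... | true  = inj₁ refl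
  ... | false = inj₂ (sym (p-involutive x))

  same-pair : ∀ {x y} → rep x ≡ rep y → y ≡ x ⊎ y ≡ p x
  same-pair {x} {y} rx≡ry with rep-member x | rep-member y
  ... | inj₁ x≡ | inj₁ y≡ = inj₁ (trans y≡ (trans (sym rx≡ry) (sym x≡)))
  ... | inj₁ x≡ | inj₂ y≡ = inj₂ (trans y≡ (cong p (trans (sym rx≡ry) (sym x≡))))
  ... | inj₂ x≡ | inj₁ y≡ = inj₂ (trans y≡ (trans (sym rx≡ry) (sym (trans (cong p x≡) (p-involutive _)))))
  ... | inj₂ x≡ | inj₂ y≡ = inj₁ (trans y≡ (trans (cong p (sym rx≡ry)) (sym x≡)))

  points-pʳ : ∀ x y → points x (p y) ≡ not (points x y)
  points-pʳ x y rewrite rep-p y | isLower-p y =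
    trans (cong (does (rep x <? rep y) xor_) (sym (not-distribʳ-xor (isLower x) (isLower y))))
          (sym (not-distribʳ-xor (does (rep x <? rep y)) (isLower x xor isLower y)))

  points-pˡ : ∀ x y → points (p x) y ≡ not (points x y)
  points-pˡ x y rewrite rep-p x | isLower-p x =
    trans (cong (does (rep x <? rep y) xor_) (sym (not-distribˡ-xor (isLower x) (isLower y))))
          (sym (not-distribʳ-xor (does (rep x <? rep y)) (isLower x xor isLower y)))

  points-swap : ∀ {x y} → rep x ≢ rep y → points y x ≡ not (points x y)
  points-swap {x} {y} rx≢ry rewrite <?-flip rx≢ry =
    trans (cong (not (does (rep x <? rep y)) xor_) (xor-comm (isLower y) (isLower x)))
          (sym (not-distribˡ-xor (does (rep x <? rep y)) (isLower x xor isLower y)))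

  Arc? : ∀ u v → Dec (Arc u v)
  Arc? u v = ¬? (v ≟ u) ×-dec ¬? (v ≟ p u) ×-dec (points u v Bool.≟ true)

  rep-≢ : ∀ {u v} → v ≢ u → v ≢ p u → rep u ≢ rep v
  rep-≢ v≢u v≢pu ru≡rv = [ v≢u , v≢pu ]′ (same-pair ru≡rv)

  Arc-between-pairs : ∀ {u v} → rep u ≢ rep v → points u v ≡ true → Arc u v
  Arc-between-pairs {u} ru≢rv uv =
    (λ v≡u → ru≢rv (cong rep (sym v≡u))) , (λ v≡pu → ru≢rv (trans (sym (rep-p u)) (cong rep (sym v≡pu)))) , uv

  Arc⇒rep-≢ : ∀ {u v} → Arc u v → rep u ≢ rep v
  Arc⇒rep-≢ (v≢u , v≢pu , _) = rep-≢ v≢u v≢pu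

  Arc-asym : ∀ {u v} → Arc u v → ¬ Arc v u
  Arc-asym u→v@(_ , _ , uv) (_ , _ , vu) =
    contradiction (trans (sym vu) (trans (points-swap (Arc⇒rep-≢ u→v)) (cong not uv))) λ ()

  Arc-total : ∀ {u v} → v ≢ u → v ≢ p u → Arc u v ⊎ Arc v u
  Arc-total {u} {v} v≢u v≢pu with points u v Bool.≟ true
  ... | yes uv = inj₁ (v≢u , v≢pu , uv)
  ... | no ¬uv = inj₂ (Arc-between-pairs (ru≢rv ∘ sym) (trans (points-swap ru≢rv) (cong not (¬-not ¬uv))))
    where
    ru≢rv : rep u ≢ rep v
    ru≢rv = rep-≢ v≢u v≢pu

  Arc-unique-in-pair : ∀ {u u' w} → rep u ≡ rep u' → Arc u w → Arc u' w → u' ≡ u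
  Arc-unique-in-pair ru≡ru' (_ , _ , uw) (_ , _ , u'w) with same-pair ru≡ru'
  ... | inj₁ u'≡u = u'≡u
  ... | inj₂ refl = contradiction (trans (sym u'w) (trans (points-pˡ _ _) (cong not uw))) λ ()

  outNbrs : Fin n → List (Fin n)
  outNbrs c = filter (Arc? c) (allFin n)

  ∈-outNbrs⁺ : ∀ {c y} → Arc c y → y ∈ outNbrs c
  ∈-outNbrs⁺ {c} {y} = ∈-filter⁺ (Arc? c) (∈-allFin y)

  ∈-outNbrs⁻ : ∀ {c y} → y ∈ outNbrs c → Arc c y
  ∈-outNbrs⁻ {c} = proj₂ ∘ ∈-filter⁻ (Arc? c) {xs = allFin n}

  length-outNbrs : ∀ c → 2 * length (outNbrs c) + 2 ≡ n
  length-outNbrs c = length-filter-transversal p p-involutive (Arc? c) c (p-fixpoint-free c)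
    (λ (y≢c , y≢pc , _) → y≢c , y≢pc) Arc-p-excluded Arc-meets-pair
    where
    Arc-p-excluded : ∀ {y} → Arc c y → ¬ Arc c (p y)
    Arc-p-excluded {y} (_ , _ , cy) (_ , _ , cpy) =
      contradiction (trans (sym cpy) (trans (points-pʳ c y) (cong not cy))) λ ()
    Arc-meets-pair : ∀ {y} → y ≢ c → y ≢ p c → Arc c y ⊎ Arc c (p y)
    Arc-meets-pair {y} y≢c y≢pc with points c y Bool.≟ true
    ... | yes cy = inj₁ (y≢c , y≢pc , cy)
    ... | no ¬cy = inj₂ (Arc-between-pairs (λ rc≡rpy → rep-≢ y≢c y≢pc (trans rc≡rpy (rep-p y)))
                                           (trans (points-pʳ c y) (cong not (¬-not ¬cy))))

  pairFactor : Fin n → Graph n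
  pairFactor r = record
    { Adj    = λ u v → (rep u ≡ r × Arc u v) ⊎ (rep v ≡ r × Arc v u)
    ; sym    = Sum.swap
    ; irrefl = [ (λ (_ , u≢u , _) → u≢u refl) , (λ (_ , u≢u , _) → u≢u refl) ]′
    }

  module PairFactor (r : Fin n) (r-lower : isLower r ≡ true) where

    rep-r : rep r ≡ r
    rep-r rewrite r-lower = refl

    rep-pr : rep (p r) ≡ r
    rep-pr = trans (rep-p r) rep-r

    centre : Fin n → Fin n
    centre v with rep v ≟ r | points r v Bool.≟ true
    ... | yes _ | _     = v
    ... | no _  | yes _ = r
    ... | no _  | no _  = p r

    centre-spec : ∀ v → (centre v ≡ v × rep v ≡ r) ⊎ (rep (centre v) ≡ r × Arc (centre v) v)
    centre-spec v with rep v ≟ r | points r v Bool.≟ true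
    ... | yes rv≡r | _      = inj₁ (refl , rv≡r)
    ... | no rv≢r  | yes rv = inj₂ (rep-r , Arc-between-pairs (λ rr≡rv → rv≢r (trans (sym rr≡rv) rep-r)) rv)
    ... | no rv≢r  | no ¬rv = inj₂ (rep-pr , Arc-between-pairs (λ rpr≡rv → rv≢r (trans (sym rpr≡rv) rep-pr))
                                                              (trans (points-pˡ r v) (cong not (¬-not ¬rv))))

    centre-rep : ∀ v → rep (centre v) ≡ r
    centre-rep v = [ (λ (cv≡v , rv≡r) → trans (cong rep cv≡v) rv≡r) , proj₁ ]′ (centre-spec v)

    centre-of-member : ∀ {u} → rep u ≡ r → centre u ≡ u
    centre-of-member {u} ru≡r with centre-spec u
    ... | inj₁ (cu≡u , _)     = cu≡u
    ... | inj₂ (rcu≡r , cu→u) = contradiction (trans rcu≡r (sym ru≡r)) (Arc⇒rep-≢ cu→u)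

    centre-of-target : ∀ {u w} → rep u ≡ r → Arc u w → centre w ≡ u
    centre-of-target {u} {w} ru≡r u→w with centre-spec w
    ... | inj₁ (_ , rw≡r)     = contradiction (trans ru≡r (sym rw≡r)) (Arc⇒rep-≢ u→w)
    ... | inj₂ (rcw≡r , cw→w) = Arc-unique-in-pair (trans ru≡r (sym rcw≡r)) u→w cw→w

    Adj-centre : ∀ {u w} → Adj (pairFactor r) u w → centre u ≡ centre w
    Adj-centre (inj₁ (ru≡r , u→w)) = trans (centre-of-member ru≡r) (sym (centre-of-target ru≡r u→w))
    Adj-centre (inj₂ (rw≡r , w→u)) = trans (centre-of-target rw≡r w→u) (sym (centre-of-member rw≡r))

    Reach-centre : ∀ {u w} → Reach (pairFactor r) u w → centre u ≡ centre w
    Reach-centre ε        = refl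
    Reach-centre (e ◅ es) = trans (Adj-centre e) (Reach-centre es)

    Reach-to-centre : ∀ v → Reach (pairFactor r) v (centre v)
    Reach-to-centre v with centre-spec v
    ... | inj₁ (cv≡v , _) rewrite cv≡v = ε
    ... | inj₂ c→v                      = inj₂ c→v ◅ ε

    star : Fin n → List (Fin n)
    star c = c ∷ outNbrs c

    ∈-star-centre : ∀ w → w ∈ star (centre w)
    ∈-star-centre w with centre-spec w
    ... | inj₁ (cw≡w , _) = here (sym cw≡w)
    ... | inj₂ (_ , cw→w) = there (∈-outNbrs⁺ cw→w)

    star-reachable : ∀ {v w} → w ∈ star (centre v) → Reach (pairFactor r) v w
    star-reachable {v} (here w≡cv) = subst (Reach (pairFactor r) v) (sym w≡cv) (Reach-to-centre v)
    star-reachable {v} (there w∈)  =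
      Reach-to-centre v ◅◅ (inj₁ (centre-rep v , ∈-outNbrs⁻ w∈) ◅ ε)

    component : ∀ v w → Reach (pairFactor r) v w ⇔ w ∈ star (centre v)
    component v w = mk⇔
      (λ v↝w → subst (λ c → w ∈ star c) (sym (Reach-centre v↝w)) (∈-star-centre w))
      star-reachable

    star-isStarOn : ∀ {c} → rep c ≡ r → length (outNbrs c) ≡ 5 → IsStarOn (pairFactor r) c (star c)
    star-isStarOn {c} rc≡r deg = unique , cong suc deg , here refl , λ x∈ y∈ → mk⇔ (to x∈ y∈) (from x∈ y∈)
      where
      unique : Unique (star c)
      unique = All.tabulate (λ y∈ c≡y → proj₁ (∈-outNbrs⁻ y∈) (sym c≡y)) ∷ filter⁺ (Arc? c) (allFin⁺ n)
      in-pair⇒centre : ∀ {x} → x ∈ star c → rep x ≡ r → x ≡ c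
      in-pair⇒centre (here x≡c) _    = x≡c
      in-pair⇒centre (there x∈) rx≡r = contradiction (trans rc≡r (sym rx≡r)) (Arc⇒rep-≢ (∈-outNbrs⁻ x∈))
      to : ∀ {x y} → x ∈ star c → y ∈ star c → Adj (pairFactor r) x y → (x ≡ c × y ≢ c) ⊎ (y ≡ c × x ≢ c)
      to x∈ _ (inj₁ (rx≡r , (y≢x , _))) with in-pair⇒centre x∈ rx≡r
      ... | refl = inj₁ (refl , y≢x)
      to _ y∈ (inj₂ (ry≡r , (x≢y , _))) with in-pair⇒centre y∈ ry≡r
      ... | refl = inj₂ (refl , x≢y)
      from : ∀ {x y} → x ∈ star c → y ∈ star c → (x ≡ c × y ≢ c) ⊎ (y ≡ c × x ≢ c) → Adj (pairFactor r) x y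
      from _          (here y≡c) (inj₁ (_ , y≢c))  = contradiction y≡c y≢c
      from _          (there y∈) (inj₁ (refl , _)) = inj₁ (rc≡r , ∈-outNbrs⁻ y∈)
      from (here x≡c) _          (inj₂ (_ , x≢c))  = contradiction x≡c x≢c
      from (there x∈) _          (inj₂ (refl , _)) = inj₂ (rc≡r , ∈-outNbrs⁻ x∈)

  isLower? : ∀ x → Dec (isLower x ≡ true)
  isLower? x = isLower x Bool.≟ true

  lowers : List (Fin n)
  lowers = filter isLower? (allFin n)

  lowers-unique : Unique lowers
  lowers-unique = filter⁺ isLower? (allFin⁺ n)

  lowers-lower : ∀ i → isLower (lookup lowers i) ≡ true
  lowers-lower i = proj₂ (∈-filter⁻ isLower? {xs = allFin n} (∈-lookup i))

  rep∈lowers : ∀ x → rep x ∈ lowers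
  rep∈lowers x = ∈-filter⁺ isLower? (∈-allFin (rep x)) (isLower-rep x)

  factor : Fin (length lowers) → Graph n
  factor i = pairFactor (lookup lowers i)

  factorOf : Fin n → Fin (length lowers)
  factorOf x = index (rep∈lowers x)

  lookup-factorOf : ∀ x → lookup lowers (factorOf x) ≡ rep x
  lookup-factorOf x = sym (lookup-index (rep∈lowers x))

  Arc⇒unique-factor : ∀ {u v} → Arc u v →
    Σ (Fin (length lowers)) λ i → Adj (factor i) u v × (∀ j → Adj (factor j) u v → j ≡ i)
  Arc⇒unique-factor {u} {v} u→v = factorOf u , inj₁ (sym (lookup-factorOf u) , u→v) , only
    where
    only : ∀ j → Adj (factor j) u v → j ≡ factorOf u
    only j (inj₁ (ru≡ , _)) = lookup-injective lowers-unique (trans (sym ru≡) (sym (lookup-factorOf u)))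
    only j (inj₂ (_ , v→u)) = contradiction v→u (Arc-asym u→v)

  starFactorDecomposition : (H : Graph n) → (∀ {u v} → Adj H u v ⇔ (v ≢ u × v ≢ p u)) →
    (∀ c → length (outNbrs c) ≡ 5) → HasStarFactorDecomposition H
  starFactorDecomposition H H-adj outNbrs-5 = length lowers , factor , factor-is5StarFactor , edge-in-unique-factor
    where
    factor⊆H : ∀ i → factor i ⊆G H
    factor⊆H i (inj₁ (_ , v≢u , v≢pu , _)) = Equivalence.from H-adj (v≢u , v≢pu)
    factor⊆H i (inj₂ (_ , u≢v , u≢pv , _)) = Graph.sym H (Equivalence.from H-adj (u≢v , u≢pv))

    factor-is5StarFactor : ∀ i → Is5StarFactor H (factor i)
    factor-is5StarFactor i = factor⊆H i ,
      λ v → star (centre v) , centre v , component v , star-isStarOn (centre-rep v) (outNbrs-5 (centre v))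
      where open PairFactor (lookup lowers i) (lowers-lower i)

    edge-in-unique-factor : ∀ {u v} → Adj H u v →
      Σ (Fin (length lowers)) λ i → Adj (factor i) u v × (∀ j → Adj (factor j) u v → j ≡ i)
    edge-in-unique-factor uv with Arc-total (proj₁ (Equivalence.to H-adj uv)) (proj₂ (Equivalence.to H-adj uv))
    ... | inj₁ u→v = Arc⇒unique-factor u→v
    ... | inj₂ v→u with Arc⇒unique-factor v→u
    ...   | i , vu∈i , only = i , Sum.swap vu∈i , λ j uv∈j → only j (Sum.swap uv∈j)

lemma6p3 : (I : Graph 12) → IsPerfectMatching (K 12) I →
    HasStarFactorDecomposition (K 12 ─ I)
lemma6p3 I (I⊆K , I-perfect) =
  starFactorDecomposition (K 12 ─ I) (mk⇔ to from) (λ c → twice-plus-2≡12 (length-outNbrs c))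
  where
  partner : Fin 12 → Fin 12
  partner v = proj₁ (I-perfect v)
  I-partner : ∀ v → Adj I v (partner v)
  I-partner v = proj₁ (proj₂ (I-perfect v))
  I⇒partner : ∀ {v w} → Adj I v w → w ≡ partner v
  I⇒partner {v} {w} = proj₂ (proj₂ (I-perfect v)) w
  partner-involutive : ∀ v → partner (partner v) ≡ v
  partner-involutive v = sym (I⇒partner (Graph.sym I (I-partner v)))
  partner-fixpoint-free : ∀ v → partner v ≢ v
  partner-fixpoint-free v pv≡v = I⊆K (I-partner v) (sym pv≡v)

  open PairOrientation partner partner-involutive partner-fixpoint-free

  to : ∀ {u v} → Adj (K 12 ─ I) u v → v ≢ u × v ≢ partner u
  to {u} (u≢v , ¬uIv) = u≢v ∘ sym , λ v≡pu → ¬uIv (subst (Adj I u) (sym v≡pu) (I-partner u))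
  from : ∀ {u v} → v ≢ u × v ≢ partner u → Adj (K 12 ─ I) u v
  from (v≢u , v≢pu) = v≢u ∘ sym , v≢pu ∘ I⇒partner

  twice-plus-2≡12 : ∀ {s} → 2 * s + 2 ≡ 12 → s ≡ 5
  twice-plus-2≡12 {s} eq = *-cancelˡ-≡ s 5 2 (+-cancelʳ-≡ 2 (2 * s) 10 eq)
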